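{- For any formulas $\alpha,\beta$ over a finite signature $\Sigma$, $[\![\alpha\to\beta]\!]=\overline{[\![\alpha]\!]}_c\downarrow\ \cup\ \big(\overline{[\![\alpha]\!]}\cap[\![\beta]\!]_c\downarrow\big)\ \cup\ [\![\beta]\!]$.
   Context: $\Sigma$ is a finite set of atoms. Formulas are given by $\alpha ::= \bot \mid p \mid \alpha_1\wedge\alpha_2 \mid \alpha_1\vee\alpha_2 \mid \alpha_1\rightarrow\alpha_2$ with $p\in\Sigma$. A partial interpretation is a map $v:\Sigma\to\{0,1,2\}$; $\mathcal I$ is the set of all of them and $\mathcal I_c$ the set of classical ones (no atom mapped to $1$). The order on $\mathcal I$: $u\le v$ iff for every atom $p$, $u(p)\le v(p)$ and ($u(p)=0$ implies $v(p)=0$). For $S\subseteq\mathcal I$: $\overline S=\mathcal I\setminus S$; $S_c=S\cap\mathcal I_c$; $S\downarrow=\{u\in\mathcal I:\exists v\in S,\ v\ge u\}$; these postfix operations bind tighter than $\cup,\cap$ and are applied left to right, so e.g. $\overline{X}_c\downarrow=((\overline X)_c)\downarrow$. The denotation: $[\![\bot]\!]=\emptyset$; $[\![p]\!]=\{v\in\mathcal I: v(p)=2\}$; $[\![\alpha\wedge\beta]\!]=[\![\alpha]\!]\cap[\![\beta]\!]$; $[\![\alpha\vee\beta]\!]=[\![\alpha]\!]\cup[\![\beta]\!]$; $[\![\alpha\to\beta]\!]=\big(\overline{[\![\alpha]\!]}\cup[\![\beta]\!]\big)\cap\big(\overline{[\![\alpha]\!]}\cup[\![\beta]\!]\big)_c\downarrow$.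 -}

module Defs where

open import Data.Nat using (ℕ)
open import Data.Fin using (Fin)
open import Data.Product using (_×_; Σ; ∃)
open import Data.Sum using (_⊎_)
open import Data.Empty using (⊥)
open import Relation.Nullary using (¬_)
open import Relation.Binary.PropositionalEquality using (_≡_)
open import Level using (0ℓ)
open import Relation.Unary using (Pred)

data V3 : Set where
  v0 v1 v2 : V3

data _≤V_ : V3 → V3 → Set where
  0≤0 : v0 ≤V v0
  0≤1 : v0 ≤V v1
  0≤2 : v0 ≤V v2
  1≤1 : v1 ≤V v1
  1≤2 : v1 ≤V v2
  2≤2 : v2 ≤V v2

-- Signature Σ = Fin n (an arbitrary finite set of atoms)
Interp : ℕ → Set
Interp n = Fin n → V3

_≤I_ : ∀ {n} → Interp n → Interp n → Set
u ≤I v = ∀ p → (u p ≤V v p) × (u p ≡ v0 → v p ≡ v0)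

Classical : ∀ {n} → Interp n → Set
Classical v = ∀ p → ¬ (v p ≡ v1)

ISet : ℕ → Set₁
ISet n = Pred (Interp n) 0ℓ

∅ : ∀ {n} → ISet n
∅ _ = ⊥

_∪_ : ∀ {n} → ISet n → ISet n → ISet n
(S ∪ T) v = S v ⊎ T v

_∩_ : ∀ {n} → ISet n → ISet n → ISet n
(S ∩ T) v = S v × T v

co : ∀ {n} → ISet n → ISet n
co S v = ¬ S v

cl : ∀ {n} → ISet n → ISet n
cl S v = S v × Classical v

down : ∀ {n} → ISet n → ISet n
down S u = Σ _ λ v → S v × (u ≤I v)

infixr 6 _∪_
infixr 7 _∩_

_≐_ : ∀ {n} → ISet n → ISet n → Set
S ≐ T = ∀ v → (S v → T v) × (T v → S v)

infix 4 _≐_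

data Form (n : ℕ) : Set where
  ⊥f   : Form n
  atom : Fin n → Form n
  _∧f_ _∨f_ _⇒f_ : Form n → Form n → Form n

⟦_⟧ : ∀ {n} → Form n → ISet n
⟦ ⊥f ⟧ = ∅
⟦ atom p ⟧ v = v p ≡ v2
⟦ α ∧f β ⟧ = ⟦ α ⟧ ∩ ⟦ β ⟧
⟦ α ∨f β ⟧ = ⟦ α ⟧ ∪ ⟦ β ⟧
⟦ α ⇒f β ⟧ = (co ⟦ α ⟧ ∪ ⟦ β ⟧) ∩ down (cl (co ⟦ α ⟧ ∪ ⟦ β ⟧))

module Submission where

-- Above any x there is exactly one classical interpretation: its closure, which raises every 1 to 2.
-- Hence the denotation of every formula persists from x to any classical w ≥ x, since all such w
-- coincide. Consequently ¬α passes down from a classical interpretation, β passes up to the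
-- closure, and the implication set (¬α ∪ β) ∩ (¬α ∪ β)_c↓ splits into the three stated pieces.

open import Data.Nat using (ℕ)
open import Data.Product using (_×_; _,_)
open import Data.Sum using (inj₁; inj₂)
open import Data.Empty using (⊥-elim)
open import Function using (id)
open import Relation.Binary.PropositionalEquality using (_≡_; _≢_; refl; sym; trans; cong; subst₂)
open import Relation.Unary using (_⊆_)
open import Defs

_⊑_ : V3 → V3 → Set
a ⊑ b = a ≤V b × (a ≡ v0 → b ≡ v0)

⊑-refl : ∀ a → a ⊑ a
⊑-refl v0 = 0≤0 , id
⊑-refl v1 = 1≤1 , id
⊑-refl v2 = 2≤2 , id

closureV : V3 → V3
closureV v0 = v0
closureV v1 = v2
closureV v2 = v2

⊑-closureV : ∀ a → a ⊑ closureV a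
⊑-closureV v0 = 0≤0 , id
⊑-closureV v1 = 1≤2 , λ ()
⊑-closureV v2 = 2≤2 , λ ()

closureV≢v1 : ∀ a → closureV a ≢ v1
closureV≢v1 v0 ()
closureV≢v1 v2 ()

classical-⊑⇒≡closureV : ∀ {a b} → a ⊑ b → b ≢ v1 → b ≡ closureV a
classical-⊑⇒≡closureV (0≤0 , _)  _    = refl
classical-⊑⇒≡closureV (0≤1 , h)  _    = h refl
classical-⊑⇒≡closureV (0≤2 , h)  _    = h refl
classical-⊑⇒≡closureV (1≤1 , _)  b≢v1 = ⊥-elim (b≢v1 refl)
classical-⊑⇒≡closureV (1≤2 , _)  _    = refl
classical-⊑⇒≡closureV (2≤2 , _)  _    = refl

module _ {n : ℕ} where

  closure : Interp n → Interp n
  closure x p = closureV (x p)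

  ≤I-refl : (w : Interp n) → w ≤I w
  ≤I-refl w p = ⊑-refl (w p)

  ≤I-closure : (x : Interp n) → x ≤I closure x
  ≤I-closure x p = ⊑-closureV (x p)

  closure-classical : (x : Interp n) → Classical (closure x)
  closure-classical x p = closureV≢v1 (x p)

  classical-upper-bounds-≤I : ∀ {x w w' : Interp n} → Classical w → Classical w' → x ≤I w → x ≤I w' → w ≤I w'
  classical-upper-bounds-≤I {x} cw cw' x≤w x≤w' p =
    subst₂ _⊑_ (sym (classical-⊑⇒≡closureV (x≤w p) (cw p)))
               (sym (classical-⊑⇒≡closureV (x≤w' p) (cw' p)))
               (⊑-refl (closureV (x p)))

  ClassicallyPersistent : ISet n → Set
  ClassicallyPersistent S = ∀ {x w : Interp n} → Classical w → x ≤I w → S x → S w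

  ⟦⟧-classicallyPersistent : (φ : Form n) → ClassicallyPersistent ⟦ φ ⟧
  ⟦⟧-classicallyPersistent ⊥f _ _ ()
  ⟦⟧-classicallyPersistent (atom p) cw x≤w xp≡v2 =
    trans (classical-⊑⇒≡closureV (x≤w p) (cw p)) (cong closureV xp≡v2)
  ⟦⟧-classicallyPersistent (φ ∧f ψ) cw x≤w (a , b) =
    ⟦⟧-classicallyPersistent φ cw x≤w a , ⟦⟧-classicallyPersistent ψ cw x≤w b
  ⟦⟧-classicallyPersistent (φ ∨f ψ) cw x≤w (inj₁ a) = inj₁ (⟦⟧-classicallyPersistent φ cw x≤w a)
  ⟦⟧-classicallyPersistent (φ ∨f ψ) cw x≤w (inj₂ b) = inj₂ (⟦⟧-classicallyPersistent ψ cw x≤w b)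
  ⟦⟧-classicallyPersistent (φ ⇒f ψ) {w = w} cw x≤w (_ , w' , (s , cw') , x≤w') =
    transfer s , w , (transfer s , cw) , ≤I-refl w
    where
    transfer : (co ⟦ φ ⟧ ∪ ⟦ ψ ⟧) w' → (co ⟦ φ ⟧ ∪ ⟦ ψ ⟧) w
    transfer (inj₁ ¬φw') = inj₁ λ φw →
      ¬φw' (⟦⟧-classicallyPersistent φ cw' (classical-upper-bounds-≤I cw cw' x≤w x≤w') φw)
    transfer (inj₂ ψw') =
      inj₂ (⟦⟧-classicallyPersistent ψ cw (classical-upper-bounds-≤I cw' cw x≤w' x≤w) ψw')

  down-cl-co⊆co : ∀ {S} → ClassicallyPersistent S → down (cl (co S)) ⊆ co S
  down-cl-co⊆co persistent (w , (¬Sw , cw) , x≤w) Sx = ¬Sw (persistent cw x≤w Sx)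

  ⊆-down-cl : ∀ {S} → ClassicallyPersistent S → S ⊆ down (cl S)
  ⊆-down-cl persistent {x} Sx =
    closure x , (persistent (closure-classical x) (≤I-closure x) Sx , closure-classical x) , ≤I-closure x

  ⇒-decomposition : ∀ {A B : ISet n} → down (cl A) ⊆ A → B ⊆ down (cl B) →
                    (A ∪ B) ∩ down (cl (A ∪ B)) ≐ down (cl A) ∪ (A ∩ down (cl B)) ∪ B
  ⇒-decomposition {A} {B} down-cl-A⊆A B⊆down-cl-B x = to , from
    where
    to : ((A ∪ B) ∩ down (cl (A ∪ B))) x → (down (cl A) ∪ (A ∩ down (cl B)) ∪ B) x
    to (inj₂ Bx , _)                           = inj₂ (inj₂ Bx)
    to (inj₁ Ax , w , (inj₁ Aw , cw) , x≤w)   = inj₁ (w , (Aw , cw) , x≤w)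
    to (inj₁ Ax , w , (inj₂ Bw , cw) , x≤w)   = inj₂ (inj₁ (Ax , w , (Bw , cw) , x≤w))
    from : (down (cl A) ∪ (A ∩ down (cl B)) ∪ B) x → ((A ∪ B) ∩ down (cl (A ∪ B))) x
    from (inj₁ d@(w , (Aw , cw) , x≤w))          = inj₁ (down-cl-A⊆A d) , w , (inj₁ Aw , cw) , x≤w
    from (inj₂ (inj₁ (Ax , w , (Bw , cw) , x≤w))) = inj₁ Ax , w , (inj₂ Bw , cw) , x≤w
    from (inj₂ (inj₂ Bx)) with B⊆down-cl-B Bx
    ... | w , (Bw , cw) , x≤w                    = inj₂ Bx , w , (inj₂ Bw , cw) , x≤w

proposition5 : (n : ℕ) (α β : Form n) → ⟦ α ⇒f β ⟧ ≐ down (cl (co ⟦ α ⟧)) ∪ (co ⟦ α ⟧ ∩ down (cl ⟦ β ⟧)) ∪ ⟦ β ⟧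
proposition5 n α β =
  ⇒-decomposition (down-cl-co⊆co (⟦⟧-classicallyPersistent α)) (⊆-down-cl (⟦⟧-classicallyPersistent β))
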